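{- Let $G$ be a graph and $u,v$ vertices of $G$ such that there is a unique shortest path between $u$ and $v$. Then there is no perfect matching $H$ on $V(G)$, with associated involution $\sigma$ (swapping the endpoints of each edge of $H$; its permutation matrix is the adjacency matrix of $H$), such that $\sigma$ is an automorphism of $G$ fixing no edge of $G$ and $\sigma(u)=v$.
   Context: All graphs are finite, simple and undirected. A perfect matching is a $1$-regular spanning graph. An automorphism $\sigma$ fixes an edge $\{x,y\}$ of $G$ if $\sigma(\{x,y\})=\{x,y\}$. -}

module Defs where

open import Data.Nat using (ℕ; zero; suc; _<_)
open import Data.Fin using (Fin)
open import Data.Vec using (Vec; []; _∷_; head; last)
open import Data.Product using (Σ; _×_; _,_; ∃; ∃-syntax)
open import Data.Sum using (_⊎_)
open import Data.Empty using (⊥)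
open import Data.Unit using (⊤)
open import Relation.Nullary using (¬_)
open import Relation.Binary.PropositionalEquality using (_≡_)
open import Function.Definitions using (Injective)
open import Function.Bundles using (_⇔_)

record Graph (n : ℕ) : Set₁ where
  field
    Adj     : Fin n → Fin n → Set
    sym     : ∀ {x y} → Adj x y → Adj y x
    irrefl  : ∀ {x} → ¬ Adj x x
open Graph public

Chain : ∀ {n k} → Graph n → Vec (Fin n) (suc k) → Set
Chain G (x ∷ [])     = ⊤
Chain G (x ∷ y ∷ xs) = Adj G x y × Chain G (y ∷ xs)

IsWalk : ∀ {n} → Graph n → (k : ℕ) → Vec (Fin n) (suc k) → Fin n → Fin n → Set
IsWalk G k xs u v = head xs ≡ u × last xs ≡ v × Chain G xs

IsShortestLength : ∀ {n} → Graph n → Fin n → Fin n → ℕ → Set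
IsShortestLength G u v k =
  (Σ (Vec _ (suc k)) λ xs → IsWalk G k xs u v) ×
  (∀ m → m < k → (xs : Vec _ (suc m)) → ¬ IsWalk G m xs u v)

-- There is a unique shortest u–v path (a shortest walk is automatically a path).
UniqueShortestPath : ∀ {n} → Graph n → Fin n → Fin n → Set
UniqueShortestPath G u v =
  Σ ℕ λ k → IsShortestLength G u v k ×
    Σ (Vec _ (suc k)) λ xs → IsWalk G k xs u v ×
      (∀ ys → IsWalk G k ys u v → ys ≡ xs)

IsPerfectMatching : ∀ {n} → Graph n → Set
IsPerfectMatching {n} H =
  ∀ x → Σ (Fin n) λ y → Adj H x y × (∀ z → Adj H x z → z ≡ y)

IsAssociatedInvolution : ∀ {n} → Graph n → (Fin n → Fin n) → Set
IsAssociatedInvolution H σ = ∀ x → Adj H x (σ x)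

-- σ is an automorphism of G (a bijection of Fin n, i.e. an injection,
-- preserving adjacency and non-adjacency).
IsAutomorphism : ∀ {n} → Graph n → (Fin n → Fin n) → Set
IsAutomorphism G σ =
  Injective _≡_ _≡_ σ × (∀ x y → Adj G x y ⇔ Adj G (σ x) (σ y))

FixesEdge : ∀ {n} → (Fin n → Fin n) → Fin n → Fin n → Set
FixesEdge σ x y = (σ x ≡ x × σ y ≡ y) ⊎ (σ x ≡ y × σ y ≡ x)

FixesNoEdge : ∀ {n} → Graph n → (Fin n → Fin n) → Set
FixesNoEdge G σ = ∀ x y → Adj G x y → ¬ FixesEdge σ x y

-- Let x₀ … x_k be the unique shortest u–v path. Since σ is an automorphism with
-- σ v = u and σ u = v, the sequence σ(x_k), …, σ(x₀) is again a shortest u–v walk,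
-- hence equal to the path: σ(x_{k−i}) = x_i for all i. At the middle of the path
-- this says that σ fixes the vertex x_{k/2} (k even) or swaps the two ends of the
-- edge x_{(k−1)/2} x_{(k+1)/2} (k odd). The first is impossible because σ moves
-- every vertex to its distinct partner in H; the second because σ fixes no edge.
module Submission where

open import Defs hiding (sym)
open import Data.Nat using (zero; suc)
open import Data.Fin using (Fin; zero; suc; opposite; inject₁; fromℕ)
open import Data.Vec using (Vec; []; _∷_; last; lookup; tabulate)
open import Data.Vec.Properties using (lookup∘tabulate)
open import Data.Product using (Σ; _×_; _,_; ∃; ∃₂; proj₁; proj₂)
open import Data.Sum using (_⊎_; inj₁; inj₂)
import Data.Sum as Sum
open import Data.Unit using (tt)
open import Relation.Nullary using (¬_)
open import Relation.Binary.PropositionalEquality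
  using (_≡_; _≢_; refl; sym; trans; cong; subst; subst₂)
open import Function using (_∘_)
open import Function.Bundles using (Equivalence)

opposite-inject₁ : ∀ {k} (i : Fin k) → opposite (inject₁ i) ≡ suc (opposite i)
opposite-inject₁ {suc k} zero    = refl
opposite-inject₁ {suc k} (suc i) = cong inject₁ (opposite-inject₁ i)

opposite-fromℕ : ∀ k → opposite (fromℕ k) ≡ zero
opposite-fromℕ zero    = refl
opposite-fromℕ (suc k) = cong inject₁ (opposite-fromℕ k)

opposite-fixed-suc-inject₁ : ∀ {k} {i : Fin k} → opposite i ≡ i →
                             opposite (suc (inject₁ i)) ≡ suc (inject₁ i)
opposite-fixed-suc-inject₁ {i = i} fixed =
  trans (cong inject₁ (opposite-inject₁ i)) (cong (suc ∘ inject₁) fixed)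

-- The middle vertex of 0 … k if k is even, the middle edge (indexed in Fin k) if k is odd.
opposite-midpoint : ∀ k → (∃ λ (i : Fin (suc k)) → opposite i ≡ i)
                        ⊎ (∃ λ (j : Fin k) → opposite j ≡ j)
opposite-midpoint zero          = inj₁ (zero , refl)
opposite-midpoint (suc zero)    = inj₂ (zero , refl)
opposite-midpoint (suc (suc k)) =
  Sum.map (λ (i , fixed) → suc (inject₁ i) , opposite-fixed-suc-inject₁ fixed)
          (λ (j , fixed) → suc (inject₁ j) , opposite-fixed-suc-inject₁ fixed)
          (opposite-midpoint k)

last-lookup : ∀ {A : Set} {k} (xs : Vec A (suc k)) → last xs ≡ lookup xs (fromℕ k)
last-lookup (x ∷ [])     = refl
last-lookup (x ∷ y ∷ xs) = last-lookup (y ∷ xs)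

reflect : ∀ {A : Set} {k} → (A → A) → Vec A (suc k) → Vec A (suc k)
reflect σ xs = tabulate (λ i → σ (lookup xs (opposite i)))

lookup-reflect : ∀ {A : Set} {k} (σ : A → A) (xs : Vec A (suc k)) i →
                 lookup (reflect σ xs) i ≡ σ (lookup xs (opposite i))
lookup-reflect σ xs = lookup∘tabulate (λ i → σ (lookup xs (opposite i)))

module _ {n} (G : Graph n) where

  Chain-lookup : ∀ {k} {xs : Vec (Fin n) (suc k)} → Chain G xs →
                 ∀ i → Adj G (lookup xs (inject₁ i)) (lookup xs (suc i))
  Chain-lookup {xs = x ∷ y ∷ xs} (xy , chain) zero    = xy
  Chain-lookup {xs = x ∷ y ∷ xs} (xy , chain) (suc i) = Chain-lookup chain i

  Chain-tabulate : ∀ {k} (f : Fin (suc k) → Fin n) →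
                   (∀ i → Adj G (f (inject₁ i)) (f (suc i))) → Chain G (tabulate f)
  Chain-tabulate {zero}  f adj = tt
  Chain-tabulate {suc k} f adj = adj zero , Chain-tabulate (f ∘ suc) (adj ∘ suc)

  reflect-isWalk : ∀ {k σ xs u v} → (∀ x y → Adj G x y → Adj G (σ x) (σ y)) →
                   IsWalk G k xs u v → IsWalk G k (reflect σ xs) (σ v) (σ u)
  reflect-isWalk {k} {σ} {xs@(_ ∷ _)} hom (refl , refl , chain) = head-ok , last-ok , chain-ok
    where
    f : Fin (suc k) → Fin n
    f i = σ (lookup xs (opposite i))

    head-ok : f zero ≡ σ (last xs)
    head-ok = cong σ (sym (last-lookup xs))

    last-ok : last (tabulate f) ≡ σ (lookup xs zero)
    last-ok = trans (last-lookup (tabulate f))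
                    (trans (lookup∘tabulate f (fromℕ k)) (cong (σ ∘ lookup xs) (opposite-fromℕ k)))

    chain-ok : Chain G (tabulate f)
    chain-ok = Chain-tabulate f λ i →
      subst (λ j → Adj G (σ (lookup xs j)) (f (suc i))) (sym (opposite-inject₁ i))
            (hom _ _ (Graph.sym G (Chain-lookup chain (opposite i))))

  reflect-fixed⇒fixesVertexOrEdge :
    ∀ {k σ} {xs : Vec (Fin n) (suc k)} → Chain G xs → reflect σ xs ≡ xs →
    (∃ λ x → σ x ≡ x) ⊎ (∃₂ λ x y → Adj G x y × FixesEdge σ x y)
  reflect-fixed⇒fixesVertexOrEdge {k} {σ} {xs} chain reflect≡xs =
    fromMidpoint (opposite-midpoint k)
    where
    mirror : ∀ i → σ (lookup xs (opposite i)) ≡ lookup xs i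
    mirror i = trans (sym (lookup-reflect σ xs i)) (cong (λ zs → lookup zs i) reflect≡xs)

    fromMidpoint : (∃ λ (i : Fin (suc k)) → opposite i ≡ i) ⊎ (∃ λ (j : Fin k) → opposite j ≡ j) →
                   (∃ λ x → σ x ≡ x) ⊎ (∃₂ λ x y → Adj G x y × FixesEdge σ x y)
    fromMidpoint (inj₁ (i , fixed)) =
      inj₁ (lookup xs i , trans (cong (σ ∘ lookup xs) (sym fixed)) (mirror i))
    fromMidpoint (inj₂ (j , fixed)) =
      inj₂ (_ , _ , Chain-lookup chain j , inj₂ (σ-left , σ-right))
      where
      σ-left : σ (lookup xs (inject₁ j)) ≡ lookup xs (suc j)
      σ-left = trans (cong (σ ∘ lookup xs ∘ inject₁) (sym fixed)) (mirror (suc j))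

      σ-right : σ (lookup xs (suc j)) ≡ lookup xs (inject₁ j)
      σ-right = trans (cong (σ ∘ lookup xs) (trans (cong suc (sym fixed)) (sym (opposite-inject₁ j))))
                      (mirror (inject₁ j))

module AssociatedInvolution {n} (H : Graph n) (σ : Fin n → Fin n)
                            (partner : IsAssociatedInvolution H σ) where

  fixedPointFree : ∀ x → σ x ≢ x
  fixedPointFree x σx≡x = Graph.irrefl H (subst (Adj H x) σx≡x (partner x))

  involutive : IsPerfectMatching H → ∀ x → σ (σ x) ≡ x
  involutive perfect x =
    trans (unique (σ (σ x)) (partner (σ x))) (sym (unique x (Graph.sym H (partner x))))
    where
    unique : ∀ z → Adj H (σ x) z → z ≡ proj₁ (perfect (σ x))
    unique = proj₂ (proj₂ (perfect (σ x)))

mainTheorem10 : ∀ {n} (G : Graph n) (u v : Fin n) →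
    UniqueShortestPath G u v →
    ¬ (Σ (Graph n) λ H → Σ (Fin n → Fin n) λ σ →
         IsPerfectMatching H × IsAssociatedInvolution H σ ×
         IsAutomorphism G σ × FixesNoEdge G σ × σ u ≡ v)
mainTheorem10 G u v (k , _ , xs , walk@(_ , _ , chain) , unique)
              (H , σ , perfect , partner , (_ , automorphism) , fixesNoEdge , σu≡v) =
  Sum.[ (λ (x , σx≡x) → fixedPointFree x σx≡x)
      , (λ (x , y , xy , fixesXY) → fixesNoEdge x y xy fixesXY) ]
      (reflect-fixed⇒fixesVertexOrEdge G chain (unique (reflect σ xs) reflected-walk))
  where
  open AssociatedInvolution H σ partner

  σv≡u : σ v ≡ u
  σv≡u = trans (cong σ (sym σu≡v)) (involutive perfect u)

  reflected-walk : IsWalk G k (reflect σ xs) u v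
  reflected-walk = subst₂ (IsWalk G k _) σv≡u σu≡v
    (reflect-isWalk G {σ = σ} (λ x y → Equivalence.to (automorphism x y)) walk)
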